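{- Let $p>3$ be a prime and let $$F(n,k)=\frac{6n-2k+1}{2^{8n-2k}}\cdot\frac{\binom{2n}{n}\binom{2n+2k}{n+k}\binom{2n-2k}{n-k}\binom{n+k}{n}}{\binom{2k}{k}}$$ for nonnegative integers $n,k$. Then $$F(p-1,p-1)\equiv -3p^2-12p^3+18p^3q_p(2)\pmod{p^4}.$$
   Context: $q_p(2)=(2^{p-1}-1)/p$ is the Fermat quotient. Congruences between rational numbers are understood in the ring of rationals whose denominators are coprime to $p$. -}

module Defs where

open import Data.Nat as ℕ using (ℕ; zero; suc; _∸_; _^_)
open import Data.Nat.Combinatorics using (_C_)
open import Data.Nat.Divisibility using (_∣_)
open import Data.Integer as ℤ using (ℤ; +_)
open import Data.Rational using (ℚ; _/_; _-_; _*_; 0ℚ)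
open import Data.Product using (Σ; _×_)
open import Relation.Nullary using (¬_)
open import Relation.Binary.PropositionalEquality using (_≡_)

ℕ→ℚ : ℕ → ℚ
ℕ→ℚ n = + n / 1

ℤ→ℚ : ℤ → ℚ
ℤ→ℚ z = z / 1

-- Division of a rational by a natural number.  Only ever applied to
-- positive denominators below (the value at 0 is an irrelevant convention).
_÷ℕ_ : ℚ → ℕ → ℚ
q ÷ℕ zero    = 0ℚ
q ÷ℕ (suc d) = q * (+ 1 / suc d)

qp2 : ℕ → ℚ
qp2 p = (ℕ→ℚ (2 ^ (p ∸ 1)) - ℕ→ℚ 1) ÷ℕ p

-- F(n,k) = (6n-2k+1)/2^(8n-2k) * C(2n,n) C(2n+2k,n+k) C(2n-2k,n-k) C(n+k,n) / C(2k,k)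
-- (natural subtraction; the statement only uses n = k, where all
--  differences are the genuine ones)
F : ℕ → ℕ → ℚ
F n k =
  ℕ→ℚ ((6 ℕ.* n ∸ 2 ℕ.* k ℕ.+ 1)
        ℕ.* ((2 ℕ.* n) C n)
        ℕ.* ((2 ℕ.* n ℕ.+ 2 ℕ.* k) C (n ℕ.+ k))
        ℕ.* ((2 ℕ.* n ∸ 2 ℕ.* k) C (n ∸ k))
        ℕ.* ((n ℕ.+ k) C n))
  ÷ℕ (2 ^ (8 ℕ.* n ∸ 2 ℕ.* k) ℕ.* ((2 ℕ.* k) C k))

-- Congruence x ≡ y (mod p^e) in the ring of rationals with denominators
-- coprime to p (p prime): x - y = p^e * u / v with u ∈ ℤ, v ∈ ℕ, p ∤ v.
CongQ : ℕ → ℕ → ℚ → ℚ → Set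
CongQ p e x y =
  Σ ℤ λ u → Σ ℕ λ v → (¬ (p ∣ v)) × ((x - y) * ℕ→ℚ v ≡ ℤ→ℚ (+ (p ^ e) ℤ.* u))

module Submission where

-- With n = p - 1 one has F(n,n) = (4n+1) C(2n,n) C(4n,2n) / 2^(6n), and three uses of
-- the recurrence (m+1) C(2m+2,m+1) = 2(2m+1) C(2m,m) give
--   F(n,n) · 2^(6n) · 4(4p-1) = p² C(2p,p) C(4p,2p).
-- Vandermonde's convolution together with p ∣ C(N,i) (for p ∣ N, p ∤ i) yields
-- C(2p,p) ≡ 2 and C(4p,2p) ≡ 2 + C(2p,p)² ≡ 6 (mod p²); the row sums of Pascal's
-- triangle yield 2^(p-1) = 1 + p q_p(2), hence 2^(6n) ≡ 1 + 6p q_p(2) (mod p²).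
-- Substituting these, the claim reduces to one polynomial identity over ℤ, which is
-- transported to ℚ through the embedding ℤ → ℚ, using p ∤ 2^(6n) · 4(4p-1).

module Sums where
  open import Data.Nat
  open import Data.Nat.Properties
  open import Data.Nat.Divisibility
  open import Data.Nat.Tactic.RingSolver
  open import Data.Product using (Σ; _,_)
  open import Relation.Binary.PropositionalEquality

  sum≤ : ℕ → (ℕ → ℕ) → ℕ
  sum≤ zero    f = f 0
  sum≤ (suc k) f = f 0 + sum≤ k (λ i → f (suc i))

  sum≤-cong : ∀ k {f g : ℕ → ℕ} → (∀ i → f i ≡ g i) → sum≤ k f ≡ sum≤ k g
  sum≤-cong zero    f≡g = f≡g 0
  sum≤-cong (suc k) f≡g = cong₂ _+_ (f≡g 0) (sum≤-cong k (λ i → f≡g (suc i)))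

  sum≤-+ : ∀ k (f g : ℕ → ℕ) → sum≤ k (λ i → f i + g i) ≡ sum≤ k f + sum≤ k g
  sum≤-+ zero    f g = refl
  sum≤-+ (suc k) f g = begin
    f 0 + g 0 + sum≤ k (λ i → f (suc i) + g (suc i))
      ≡⟨ cong (f 0 + g 0 +_) (sum≤-+ k (λ i → f (suc i)) (λ i → g (suc i))) ⟩
    f 0 + g 0 + (sum≤ k (λ i → f (suc i)) + sum≤ k (λ i → g (suc i)))
      ≡⟨ +-+-interchange (f 0) (g 0) _ _ ⟩
    f 0 + sum≤ k (λ i → f (suc i)) + (g 0 + sum≤ k (λ i → g (suc i))) ∎
    where
    open ≡-Reasoning
    +-+-interchange : ∀ a b c d → a + b + (c + d) ≡ a + c + (b + d)
    +-+-interchange = solve-∀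

  sum≤-last : ∀ k (f : ℕ → ℕ) → sum≤ (suc k) f ≡ sum≤ k f + f (suc k)
  sum≤-last zero    f = refl
  sum≤-last (suc k) f =
    trans (cong (f 0 +_) (sum≤-last k (λ i → f (suc i)))) (sym (+-assoc (f 0) _ _))

  sum≤-zero : ∀ k → sum≤ k (λ _ → 0) ≡ 0
  sum≤-zero zero    = refl
  sum≤-zero (suc k) = sum≤-zero k

  sum≤-∣ : ∀ {d} k (f : ℕ → ℕ) → (∀ i → i ≤ k → d ∣ f i) → d ∣ sum≤ k f
  sum≤-∣ zero    f d∣f = d∣f 0 z≤n
  sum≤-∣ (suc k) f d∣f =
    ∣m∣n⇒∣m+n (d∣f 0 z≤n) (sum≤-∣ k (λ i → f (suc i)) (λ i i≤k → d∣f (suc i) (s≤s i≤k)))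

  sum≤-except : ∀ {d} k (f : ℕ → ℕ) r → r ≤ k → (∀ i → i ≤ k → i ≢ r → d ∣ f i) →
                Σ ℕ λ s → sum≤ k f ≡ f r + s * d
  sum≤-except zero f .zero z≤n d∣f = 0 , sym (+-identityʳ (f 0))
  sum≤-except (suc k) f zero r≤k d∣f
    with sum≤-∣ k (λ i → f (suc i)) (λ i i≤k → d∣f (suc i) (s≤s i≤k) (λ ()))
  ... | divides s eq = s , cong (f 0 +_) eq
  sum≤-except {d} (suc k) f (suc r) (s≤s r≤k) d∣f
    with d∣f 0 z≤n (λ ()) | sum≤-except k (λ i → f (suc i)) r r≤k
           (λ i i≤k i≢r → d∣f (suc i) (s≤s i≤k) (λ eq → i≢r (suc-injective eq)))
  ... | divides s₀ eq₀ | s , eq = s₀ + s , (begin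
    f 0 + sum≤ k (λ i → f (suc i)) ≡⟨ cong₂ _+_ eq₀ eq ⟩
    s₀ * d + (f (suc r) + s * d)    ≡⟨ regroup s₀ d (f (suc r)) s ⟩
    f (suc r) + (s₀ + s) * d        ∎)
    where
    open ≡-Reasoning
    regroup : ∀ a d x s → a * d + (x + s * d) ≡ x + (a + s) * d
    regroup = solve-∀

module Binomials where
  open import Data.Nat
  open import Data.Nat.Properties
  open import Data.Nat.Combinatorics using (_C_; nCk+nC[k+1]≡[n+1]C[k+1]; k>n⇒nCk≡0; nCn≡1; nC1≡n; nCk≡nC[n∸k])
  open import Data.Nat.Tactic.RingSolver
  open import Relation.Binary.PropositionalEquality
  open Sums
  open ≡-Reasoning

  pascal : ∀ n k → suc n C suc k ≡ n C k + n C suc k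
  pascal n k = sym (nCk+nC[k+1]≡[n+1]C[k+1] n k)

  C-pos : ∀ {n k} → k ≤ n → 0 < n C k
  C-pos {n}     {zero}  _         = s≤s z≤n
  C-pos {suc n} {suc k} (s≤s k≤n) =
    subst (0 <_) (sym (pascal n k)) (<-≤-trans (C-pos k≤n) (m≤m+n _ _))

  absorption : ∀ m k → suc k * (suc m C suc k) ≡ suc m * (m C k)
  absorption zero    zero    = refl
  absorption zero    (suc k) =
    trans (cong (suc (suc k) *_) (k>n⇒nCk≡0 {1} {suc (suc k)} (s≤s (s≤s z≤n)))) (*-zeroʳ (suc (suc k)))
  absorption (suc m) zero    = trans (+-identityʳ _) (trans (nC1≡n (suc (suc m))) (sym (*-identityʳ _)))
  absorption (suc m) (suc k) = begin
    suc (suc k) * (suc (suc m) C suc (suc k))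
      ≡⟨ cong (suc (suc k) *_) (pascal (suc m) (suc k)) ⟩
    suc (suc k) * (X + Z)
      ≡⟨ split k X Z ⟩
    suc k * X + X + suc (suc k) * Z
      ≡⟨ cong₂ (λ u v → u + X + v) (absorption m k) (absorption m (suc k)) ⟩
    suc m * (m C k) + X + suc m * (m C suc k)
      ≡⟨ cong (λ u → suc m * (m C k) + u + suc m * (m C suc k)) (pascal m k) ⟩
    suc m * (m C k) + (m C k + m C suc k) + suc m * (m C suc k)
      ≡⟨ merge (m C k) (m C suc k) m ⟩
    suc (suc m) * (m C k + m C suc k)
      ≡⟨ cong (suc (suc m) *_) (sym (pascal m k)) ⟩
    suc (suc m) * X ∎
    where
    X Z : ℕ
    X = suc m C suc k
    Z = suc m C suc (suc k)
    split : ∀ k x z → suc (suc k) * (x + z) ≡ suc k * x + x + suc (suc k) * z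
    split = solve-∀
    merge : ∀ a b m → suc m * a + (a + b) + suc m * b ≡ suc (suc m) * (a + b)
    merge = solve-∀

  vandermonde : ∀ m n k → (m + n) C k ≡ sum≤ k (λ i → (m C i) * (n C (k ∸ i)))
  vandermonde zero    n zero    = sym (+-identityʳ (n C 0))
  vandermonde zero    n (suc k) = sym (begin
    n C suc k + 0 + sum≤ k (λ _ → 0) ≡⟨ cong (n C suc k + 0 +_) (sum≤-zero k) ⟩
    n C suc k + 0 + 0                ≡⟨ +-identityʳ _ ⟩
    n C suc k + 0                    ≡⟨ +-identityʳ _ ⟩
    n C suc k                        ∎)
  vandermonde (suc m) n zero    = sym (+-identityʳ (n C 0))
  vandermonde (suc m) n (suc k) = begin
    suc (m + n) C suc k
      ≡⟨ pascal (m + n) k ⟩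
    (m + n) C k + (m + n) C suc k
      ≡⟨ cong₂ _+_ (vandermonde m n k) (vandermonde m n (suc k)) ⟩
    S + (1 * X + S′)
      ≡⟨ regroup S S′ X ⟩
    1 * X + (S + S′)
      ≡⟨ cong (1 * X +_) (sym (sum≤-+ k (λ i → (m C i) * (n C (k ∸ i))) (λ i → (m C suc i) * (n C (k ∸ i))))) ⟩
    1 * X + sum≤ k (λ i → (m C i) * (n C (k ∸ i)) + (m C suc i) * (n C (k ∸ i)))
      ≡⟨ cong (1 * X +_) (sum≤-cong k (λ i → trans (sym (*-distribʳ-+ (n C (k ∸ i)) (m C i) (m C suc i)))
                                                  (cong (_* (n C (k ∸ i))) (sym (pascal m i))))) ⟩
    1 * X + sum≤ k (λ i → (suc m C suc i) * (n C (k ∸ i))) ∎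
    where
    X S S′ : ℕ
    X  = n C suc k
    S  = sum≤ k (λ i → (m C i) * (n C (k ∸ i)))
    S′ = sum≤ k (λ i → (m C suc i) * (n C (k ∸ i)))
    regroup : ∀ a b x → a + (1 * x + b) ≡ 1 * x + (a + b)
    regroup = solve-∀

  row-sum : ∀ m → sum≤ m (m C_) ≡ 2 ^ m
  row-sum zero    = refl
  row-sum (suc m) = begin
    1 + sum≤ m (λ i → suc m C suc i)
      ≡⟨ cong (1 +_) (sum≤-cong m (pascal m)) ⟩
    1 + sum≤ m (λ i → m C i + m C suc i)
      ≡⟨ cong (1 +_) (sum≤-+ m (m C_) (λ i → m C suc i)) ⟩
    1 + (S + S′)
      ≡⟨ regroup S S′ ⟩
    S + sum≤ (suc m) (m C_)
      ≡⟨ cong (S +_) (trans (sum≤-last m (m C_)) (trans (cong (S +_) (k>n⇒nCk≡0 (n<1+n m))) (+-identityʳ S))) ⟩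
    S + S
      ≡⟨ cong₂ _+_ (row-sum m) (trans (row-sum m) (sym (+-identityʳ (2 ^ m)))) ⟩
    2 ^ suc m ∎
    where
    S S′ : ℕ
    S  = sum≤ m (m C_)
    S′ = sum≤ m (λ i → m C suc i)
    regroup : ∀ a b → 1 + (a + b) ≡ a + (1 + b)
    regroup = solve-∀

  central : ℕ → ℕ
  central m = (m + m) C m

  central-step : ∀ m → suc m * central (suc m) ≡ 2 * (suc (m + m) * central m)
  central-step m = begin
    suc m * ((suc m + suc m) C suc m)
      ≡⟨ cong (λ N → suc m * (N C suc m)) (cong suc (+-suc m m)) ⟩
    suc m * (suc (suc (m + m)) C suc m)
      ≡⟨ cong (suc m *_) (pascal (suc (m + m)) m) ⟩
    suc m * (suc (m + m) C m + suc (m + m) C suc m)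
      ≡⟨ cong (λ x → suc m * (x + suc (m + m) C suc m)) middle-symmetry ⟩
    suc m * (suc (m + m) C suc m + suc (m + m) C suc m)
      ≡⟨ double (suc m) (suc (m + m) C suc m) ⟩
    2 * (suc m * (suc (m + m) C suc m))
      ≡⟨ cong (2 *_) (absorption (m + m) m) ⟩
    2 * (suc (m + m) * central m) ∎
    where
    middle-symmetry : suc (m + m) C m ≡ suc (m + m) C suc m
    middle-symmetry = trans (nCk≡nC[n∸k] (≤-trans (m≤m+n m m) (n≤1+n _)))
                            (cong (suc (m + m) C_) (trans (+-∸-assoc 1 (m≤m+n m m)) (cong suc (m+n∸m≡n m m))))
    double : ∀ a x → a * (x + x) ≡ 2 * (a * x)
    double = solve-∀

module Powers where
  open import Data.Nat
  open import Data.Nat.Properties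
  open import Data.Nat.Tactic.RingSolver
  open import Data.Product using (Σ; _,_)
  open import Relation.Binary.PropositionalEquality
  open ≡-Reasoning

  power-expansion : ∀ m x k → Σ ℕ λ s → (1 + m * x) ^ k ≡ 1 + (k * x + s * m) * m
  power-expansion m x zero    = 0 , refl
  power-expansion m x (suc k) with power-expansion m x k
  ... | s , eq = s + k * x * x + s * x * m , (begin
    (1 + m * x) * (1 + m * x) ^ k             ≡⟨ cong ((1 + m * x) *_) eq ⟩
    (1 + m * x) * (1 + (k * x + s * m) * m)   ≡⟨ expand m x k s ⟩
    1 + (suc k * x + (s + k * x * x + s * x * m) * m) * m ∎)
    where
    expand : ∀ m x k s → (1 + m * x) * (1 + (k * x + s * m) * m)
                         ≡ 1 + (suc k * x + (s + k * x * x + s * x * m) * m) * m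
    expand = solve-∀

  sixth-power : ∀ n p q → 2 ^ n ≡ 1 + p * q → Σ ℕ λ s → 2 ^ (6 * n) ≡ 1 + (6 * q + s * p) * p
  sixth-power n p q 2^n≡ =
    let s , expansion = power-expansion p q 6 in
    s , (begin
      2 ^ (6 * n)          ≡⟨ cong (2 ^_) (*-comm 6 n) ⟩
      2 ^ (n * 6)          ≡⟨ sym (^-*-assoc 2 n 6) ⟩
      (2 ^ n) ^ 6          ≡⟨ cong (_^ 6) 2^n≡ ⟩
      (1 + p * q) ^ 6      ≡⟨ expansion ⟩
      1 + (6 * q + s * p) * p ∎)

module Primes where
  open import Data.Nat
  open import Data.Nat.Properties
  open import Data.Nat.Divisibility
  open import Data.Nat.Primality using (Prime; euclidsLemma; prime⇒nonTrivial)
  open import Data.Nat.Tactic.RingSolver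
  open import Data.Sum using (inj₁; inj₂)
  open import Relation.Nullary using (¬_)
  open import Relation.Binary.PropositionalEquality

  prime>1 : ∀ {p} → Prime p → 1 < p
  prime>1 {p} pr = nonTrivial⇒n>1 p {{prime⇒nonTrivial pr}}

  prime∤* : ∀ {p m n} → Prime p → ¬ p ∣ m → ¬ p ∣ n → ¬ p ∣ m * n
  prime∤* {p} {m} {n} pr p∤m p∤n p∣mn with euclidsLemma m n pr p∣mn
  ... | inj₁ p∣m = p∤m p∣m
  ... | inj₂ p∣n = p∤n p∣n

  prime∤^ : ∀ {p m} → Prime p → ¬ p ∣ m → ∀ k → ¬ p ∣ m ^ k
  prime∤^ pr p∤m zero    = >⇒∤ (prime>1 pr)
  prime∤^ pr p∤m (suc k) = prime∤* pr p∤m (prime∤^ pr p∤m k)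

  ∤-below-multiple : ∀ {p x k} → 1 < p → x + 1 ≡ k * p → ¬ p ∣ x
  ∤-below-multiple {p} {x} {k} 1<p eq p∣x =
    >⇒∤ 1<p (∣m+n∣m⇒∣n (subst (p ∣_) (sym eq) (n∣m*n k)) p∣x)

  ∤-below-double : ∀ {p x} → 0 < x → x < p + p → x ≢ p → ¬ p ∣ x
  ∤-below-double {p} 0<x x<2p x≢p (divides zero          refl) = <-irrefl refl 0<x
  ∤-below-double {p} 0<x x<2p x≢p (divides (suc zero)    refl) = x≢p (+-identityʳ p)
  ∤-below-double {p} 0<x x<2p x≢p (divides (suc (suc q)) refl) =
    <⇒≱ x<2p (+-monoʳ-≤ p (m≤m+n p (q * p)))

  -- For an odd prime p = n + 1, p ∤ 2^(6n) · 4 (4n + 3), since 4n + 3 = 4p - 1.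
  ∤-denominator : ∀ n → Prime (suc n) → 2 < suc n → ¬ suc n ∣ 2 ^ (6 * n) * (4 * (4 * n + 3))
  ∤-denominator n pr 2<p =
    prime∤* pr (prime∤^ pr p∤2 (6 * n))
               (prime∤* pr (prime∤^ pr p∤2 2) (∤-below-multiple {k = 4} (prime>1 pr) (four-n n)))
    where
    p∤2 : ¬ suc n ∣ 2
    p∤2 = >⇒∤ 2<p
    four-n : ∀ n → 4 * n + 3 + 1 ≡ 4 * suc n
    four-n = solve-∀


module PrimeBinomials where
  open import Data.Nat
  open import Data.Nat.Properties
  open import Data.Nat.Divisibility
  open import Data.Nat.Primality using (Prime; euclidsLemma)
  open import Data.Nat.Combinatorics using (_C_; nCn≡1)
  open import Data.Nat.Tactic.RingSolver
  open import Data.Product using (Σ; _,_)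
  open import Data.Sum using (inj₁; inj₂)
  open import Relation.Nullary using (¬_; contradiction)
  open import Relation.Binary.PropositionalEquality
  open Sums
  open Binomials
  open Primes
  open ≡-Reasoning

  -- If p is prime, p ∣ N and p ∤ i, then p ∣ C(N,i)  (from the absorption identity).
  prime∣binomial : ∀ {p N i} → Prime p → p ∣ N → ¬ p ∣ i → p ∣ N C i
  prime∣binomial {p} {N}     {zero}  _  _   p∤i = contradiction (p ∣0) p∤i
  prime∣binomial {p} {zero}  {suc k} _  _   _   = p ∣0
  prime∣binomial {p} {suc m} {suc k} pr p∣N p∤i
    with euclidsLemma (suc k) (suc m C suc k) pr
           (subst (p ∣_) (sym (absorption m k)) (∣m⇒∣m*n (m C k) p∣N))
  ... | inj₁ p∣i = contradiction p∣i p∤i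
  ... | inj₂ p∣C = p∣C

  central-split : ∀ j → let m = 2 + j in
                  central m ≡ 2 + sum≤ j (λ i → (m C suc i) * (m C (m ∸ suc i)))
  central-split j = begin
    central m                                      ≡⟨ vandermonde m m m ⟩
    1 * (m C m) + sum≤ (suc j) inner               ≡⟨ cong₂ _+_ (trans (+-identityʳ _) (nCn≡1 m)) (sum≤-last j inner) ⟩
    1 + (sum≤ j inner + inner (suc j))             ≡⟨ cong (λ x → 1 + (sum≤ j inner + x)) last≡1 ⟩
    1 + (sum≤ j inner + 1)                         ≡⟨ regroup (sum≤ j inner) ⟩
    2 + sum≤ j inner                               ∎
    where
    m : ℕ
    m = 2 + j
    inner : ℕ → ℕ
    inner i = (m C suc i) * (m C (m ∸ suc i))
    last≡1 : inner (suc j) ≡ 1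
    last≡1 = cong₂ _*_ (nCn≡1 m) (cong (m C_) (n∸n≡0 j))
    regroup : ∀ s → 1 + (s + 1) ≡ 2 + s
    regroup = solve-∀

  row-split : ∀ j → let m = 2 + j in 2 ^ m ≡ 2 + sum≤ j (λ i → m C suc i)
  row-split j = begin
    2 ^ m                                  ≡⟨ sym (row-sum m) ⟩
    1 + sum≤ (suc j) (λ i → m C suc i)     ≡⟨ cong (1 +_) (sum≤-last j (λ i → m C suc i)) ⟩
    1 + (sum≤ j (λ i → m C suc i) + m C m) ≡⟨ cong (λ x → 1 + (sum≤ j (λ i → m C suc i) + x)) (nCn≡1 m) ⟩
    1 + (sum≤ j (λ i → m C suc i) + 1)     ≡⟨ regroup (sum≤ j (λ i → m C suc i)) ⟩
    2 + sum≤ j (λ i → m C suc i)           ∎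
    where
    m : ℕ
    m = 2 + j
    regroup : ∀ s → 1 + (s + 1) ≡ 2 + s
    regroup = solve-∀

  ∤-reflect : ∀ {p m x} → x ≤ m → p ∣ m → ¬ p ∣ x → ¬ p ∣ m ∸ x
  ∤-reflect {p} {m} {x} x≤m p∣m p∤x p∣m-x =
    p∤x (∣m+n∣m⇒∣n (subst (p ∣_) (sym (m∸n+n≡m x≤m)) p∣m) p∣m-x)

  p²∣vandermonde-term : ∀ {p m x} → Prime p → x ≤ m → p ∣ m → ¬ p ∣ x →
                        p * p ∣ (m C x) * (m C (m ∸ x))
  p²∣vandermonde-term pr x≤m p∣m p∤x =
    *-pres-∣ (prime∣binomial pr p∣m p∤x) (prime∣binomial pr p∣m (∤-reflect x≤m p∣m p∤x))

  central-prime : ∀ p → Prime p → Σ ℕ λ a → central p ≡ 2 + a * (p * p)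
  central-prime 0 pr with prime>1 pr
  ... | ()
  central-prime 1 pr with prime>1 pr
  ... | s≤s ()
  central-prime (suc (suc j)) pr
    with sum≤-∣ j _ (λ i i≤j → p²∣vandermonde-term pr (suc-i≤p i≤j) ∣-refl (>⇒∤ (s≤s (s≤s i≤j))))
    where
    suc-i≤p : ∀ {i} → i ≤ j → suc i ≤ 2 + j
    suc-i≤p i≤j = s≤s (m≤n⇒m≤1+n i≤j)
  ... | divides a eq = a , trans (central-split j) (cong (2 +_) eq)

  -- C(4p,2p) ≡ 2 + C(2p,p)² ≡ 6 (mod p²) for every prime p.
  central-double-prime : ∀ p → Prime p → Σ ℕ λ t → central (p + p) ≡ 6 + t * (p * p)
  central-double-prime 0 pr with prime>1 pr
  ... | ()
  central-double-prime 1 pr with prime>1 pr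
  ... | s≤s ()
  central-double-prime p@(suc (suc j)) pr
    with central-prime p pr
       | sum≤-except {p * p} k _ (suc j) (≤-trans (n≤1+n (suc j)) (m≤n+m p j)) off-centre
    where
    k : ℕ
    k = j + p
    off-centre : ∀ i → i ≤ k → i ≢ suc j → p * p ∣ ((p + p) C suc i) * ((p + p) C (p + p ∸ suc i))
    off-centre i i≤k i≢p = p²∣vandermonde-term pr (s≤s (m≤n⇒m≤1+n i≤k)) (∣m∣n⇒∣m+n ∣-refl ∣-refl)
                             (∤-below-double (s≤s z≤n) (s≤s (s≤s i≤k)) (λ eq → i≢p (suc-injective eq)))
  ... | a , e≡ | s , eq = a * 4 + a * a * (p * p) + s , (begin
    central (p + p)                                        ≡⟨ central-split (j + p) ⟩
    2 + sum≤ (j + p) _                                     ≡⟨ cong (2 +_) eq ⟩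
    2 + (central p * ((p + p) C (p + p ∸ p)) + s * (p * p))
      ≡⟨ cong (λ x → 2 + (central p * ((p + p) C x) + s * (p * p))) (m+n∸m≡n p p) ⟩
    2 + (central p * central p + s * (p * p))               ≡⟨ cong (λ x → 2 + (x * x + s * (p * p))) e≡ ⟩
    2 + ((2 + a * (p * p)) * (2 + a * (p * p)) + s * (p * p)) ≡⟨ expand a s (p * p) ⟩
    6 + (a * 4 + a * a * (p * p) + s) * (p * p)             ∎)
    where
    expand : ∀ a s x → 2 + ((2 + a * x) * (2 + a * x) + s * x) ≡ 6 + (a * 4 + a * a * x + s) * x
    expand = solve-∀

  fermat-two : ∀ p → Prime p → 2 < p → Σ ℕ λ q → 2 ^ (p ∸ 1) ≡ 1 + p * q
  fermat-two p@(suc (suc j)) pr 2<p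
    with sum≤-∣ j (λ i → p C suc i) (λ i i≤j → prime∣binomial pr ∣-refl (>⇒∤ (s≤s (s≤s i≤j))))
  ... | divides b 2^p≡ with euclidsLemma 2 (2 ^ suc j ∸ 1) pr (divides b double-quotient)
    where
    double-quotient : 2 * (2 ^ suc j ∸ 1) ≡ b * p
    double-quotient = begin
      2 * (2 ^ suc j ∸ 1) ≡⟨ *-distribˡ-∸ 2 (2 ^ suc j) 1 ⟩
      2 ^ p ∸ 2           ≡⟨ cong (_∸ 2) (row-split j) ⟩
      2 + sum≤ j _ ∸ 2    ≡⟨ m+n∸m≡n 2 _ ⟩
      sum≤ j _            ≡⟨ 2^p≡ ⟩
      b * p               ∎
  ... | inj₁ p∣2 = contradiction p∣2 (>⇒∤ 2<p)
  ... | inj₂ (divides q eq) = q , (begin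
    2 ^ suc j               ≡⟨ sym (m+[n∸m]≡n (m^n>0 2 (suc j))) ⟩
    1 + (2 ^ suc j ∸ 1)     ≡⟨ cong (1 +_) (trans eq (*-comm q p)) ⟩
    1 + p * q               ∎)

module Rationals where
  open import Defs
  open import Data.Nat as ℕ using (ℕ; zero; suc)
  open import Data.Nat.Divisibility as ℕ using ()
  open import Data.Integer as ℤ using (ℤ; +_; -[1+_])
  import Data.Integer.Properties as ℤ
  open import Data.Integer.Divisibility.Signed as ℤ using (divides)
  open import Data.Rational using (ℚ; mkℚ; _/_; 1ℚ; _+_; _*_; -_; _-_)
  open import Data.Rational.Properties using (normalize-coprime; *-inverseʳ; *-identityʳ)
  open import Data.Rational.Solver using (module +-*-Solver)
  import Data.Nat.Coprimality as Coprimality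
  open import Data.Product using (_,_)
  open import Data.Empty using (⊥-elim)
  open import Relation.Nullary using (¬_)
  open import Relation.Binary.PropositionalEquality
  open +-*-Solver using (solve; _:+_; _:*_; :-_; _:=_)
  open ≡-Reasoning

  coprime-to-1 : ∀ z → Coprimality.Coprime ℤ.∣ z ∣ 1
  coprime-to-1 z = Coprimality.sym (Coprimality.1-coprimeTo ℤ.∣ z ∣)

  ℤ→ℚ-mkℚ : ∀ z → ℤ→ℚ z ≡ mkℚ z 0 (coprime-to-1 z)
  ℤ→ℚ-mkℚ (+ n)    = normalize-coprime (coprime-to-1 (+ n))
  ℤ→ℚ-mkℚ -[1+ n ] = cong -_ (normalize-coprime (coprime-to-1 (+ suc n)))

  ℤ→ℚ-+ : ∀ a b → ℤ→ℚ (a ℤ.+ b) ≡ ℤ→ℚ a + ℤ→ℚ b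
  ℤ→ℚ-+ a b rewrite ℤ→ℚ-mkℚ a | ℤ→ℚ-mkℚ b =
    cong (_/ 1) (sym (cong₂ ℤ._+_ (ℤ.*-identityʳ a) (ℤ.*-identityʳ b)))

  ℤ→ℚ-* : ∀ a b → ℤ→ℚ (a ℤ.* b) ≡ ℤ→ℚ a * ℤ→ℚ b
  ℤ→ℚ-* a b rewrite ℤ→ℚ-mkℚ a | ℤ→ℚ-mkℚ b = refl

  ℤ→ℚ-neg : ∀ a → ℤ→ℚ (ℤ.- a) ≡ - ℤ→ℚ a
  ℤ→ℚ-neg a rewrite ℤ→ℚ-mkℚ a | ℤ→ℚ-mkℚ (ℤ.- a) = neg-mkℚ a
    where
    neg-mkℚ : ∀ a → mkℚ (ℤ.- a) 0 (coprime-to-1 (ℤ.- a)) ≡ - mkℚ a 0 (coprime-to-1 a)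
    neg-mkℚ (+ zero)  = refl
    neg-mkℚ (+ suc n) = refl
    neg-mkℚ -[1+ n ]  = refl

  ℤ→ℚ-- : ∀ a b → ℤ→ℚ (a ℤ.- b) ≡ ℤ→ℚ a - ℤ→ℚ b
  ℤ→ℚ-- a b = trans (ℤ→ℚ-+ a (ℤ.- b)) (cong (λ z → ℤ→ℚ a + z) (ℤ→ℚ-neg b))

  ÷ℕ-cancel : ∀ d x → (ℕ→ℚ (suc d) * x) ÷ℕ suc d ≡ x
  ÷ℕ-cancel d x = begin
    (d′ * x) * r ≡⟨ solve 3 (λ d′ x r → (d′ :* x) :* r := x :* (d′ :* r)) refl d′ x r ⟩
    x * (d′ * r) ≡⟨ cong (x *_) d′*r≡1 ⟩
    x * 1ℚ       ≡⟨ *-identityʳ x ⟩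
    x            ∎
    where
    d′ r : ℚ
    d′ = ℕ→ℚ (suc d)
    r  = + 1 / suc d
    d′*r≡1 : d′ * r ≡ 1ℚ
    d′*r≡1 rewrite ℤ→ℚ-mkℚ (+ suc d) | normalize-coprime {1} {d} (Coprimality.1-coprimeTo _) =
      *-inverseʳ (mkℚ (+ suc d) 0 (coprime-to-1 (+ suc d)))

  ℕ→ℚ-+ : ∀ m n → ℕ→ℚ (m ℕ.+ n) ≡ ℕ→ℚ m + ℕ→ℚ n
  ℕ→ℚ-+ m n = trans (cong ℤ→ℚ (ℤ.pos-+ m n)) (ℤ→ℚ-+ (+ m) (+ n))

  ℕ→ℚ-* : ∀ m n → ℕ→ℚ (m ℕ.* n) ≡ ℕ→ℚ m * ℕ→ℚ n
  ℕ→ℚ-* m n = trans (cong ℤ→ℚ (ℤ.pos-* m n)) (ℤ→ℚ-* (+ m) (+ n))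

  ÷ℕ-exact : ∀ X D V Y → D ≢ 0 → X ℕ.* V ≡ D ℕ.* Y → (ℕ→ℚ X ÷ℕ D) * ℕ→ℚ V ≡ ℕ→ℚ Y
  ÷ℕ-exact X zero    V Y D≢0 _   = ⊥-elim (D≢0 refl)
  ÷ℕ-exact X (suc d) V Y _   X*V≡D*Y = begin
    (ℕ→ℚ X * r) * ℕ→ℚ V             ≡⟨ solve 3 (λ x r v → (x :* r) :* v := (x :* v) :* r) refl (ℕ→ℚ X) r (ℕ→ℚ V) ⟩
    (ℕ→ℚ X * ℕ→ℚ V) * r             ≡⟨ cong (_* r) (sym (ℕ→ℚ-* X V)) ⟩
    ℕ→ℚ (X ℕ.* V) * r               ≡⟨ cong (λ z → ℕ→ℚ z * r) X*V≡D*Y ⟩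
    ℕ→ℚ (suc d ℕ.* Y) * r           ≡⟨ cong (_* r) (ℕ→ℚ-* (suc d) Y) ⟩
    (ℕ→ℚ (suc d) * ℕ→ℚ Y) ÷ℕ suc d  ≡⟨ ÷ℕ-cancel d (ℕ→ℚ Y) ⟩
    ℕ→ℚ Y                           ∎
    where
    r : ℚ
    r = + 1 / suc d

  qp2-integral : ∀ n q → 2 ℕ.^ n ≡ 1 ℕ.+ suc n ℕ.* q → qp2 (suc n) ≡ ℤ→ℚ (+ q)
  qp2-integral n q 2^n≡ = begin
    (ℕ→ℚ (2 ℕ.^ n) - ℕ→ℚ 1) ÷ℕ suc n                  ≡⟨ cong (λ z → (ℕ→ℚ z - ℕ→ℚ 1) ÷ℕ suc n) 2^n≡ ⟩
    (ℕ→ℚ (1 ℕ.+ suc n ℕ.* q) - ℕ→ℚ 1) ÷ℕ suc n        ≡⟨ cong (λ z → (z - ℕ→ℚ 1) ÷ℕ suc n)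
                                                             (trans (ℕ→ℚ-+ 1 (suc n ℕ.* q)) (cong (λ z → ℕ→ℚ 1 + z) (ℕ→ℚ-* (suc n) q))) ⟩
    (ℕ→ℚ 1 + ℕ→ℚ (suc n) * ℕ→ℚ q - ℕ→ℚ 1) ÷ℕ suc n   ≡⟨ cong (_÷ℕ suc n)
                                                             (solve 3 (λ o p q → o :+ p :* q :+ (:- o) := p :* q) refl
                                                                      (ℕ→ℚ 1) (ℕ→ℚ (suc n)) (ℕ→ℚ q)) ⟩
    (ℕ→ℚ (suc n) * ℕ→ℚ q) ÷ℕ suc n                   ≡⟨ ÷ℕ-cancel n (ℕ→ℚ q) ⟩
    ℕ→ℚ q                                            ∎

  CongQ-fromℤ : ∀ p e x y v X Z → ¬ p ℕ.∣ v → x * ℕ→ℚ v ≡ ℤ→ℚ X → y ≡ ℤ→ℚ Z →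
                + (p ℕ.^ e) ℤ.∣ X ℤ.- Z ℤ.* + v → CongQ p e x y
  CongQ-fromℤ p e x y v X Z p∤v xv≡X y≡Z (divides u X-Zv≡) = u , v , p∤v , (begin
    (x - y) * ℕ→ℚ v             ≡⟨ solve 3 (λ x y v → (x :+ (:- y)) :* v := x :* v :+ (:- (y :* v))) refl x y (ℕ→ℚ v) ⟩
    x * ℕ→ℚ v - y * ℕ→ℚ v       ≡⟨ cong₂ (λ a b → a - b * ℕ→ℚ v) xv≡X y≡Z ⟩
    ℤ→ℚ X - ℤ→ℚ Z * ℤ→ℚ (+ v)   ≡⟨ cong (λ z → ℤ→ℚ X - z) (sym (ℤ→ℚ-* Z (+ v))) ⟩
    ℤ→ℚ X - ℤ→ℚ (Z ℤ.* + v)     ≡⟨ sym (ℤ→ℚ-- X (Z ℤ.* + v)) ⟩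
    ℤ→ℚ (X ℤ.- Z ℤ.* + v)       ≡⟨ cong ℤ→ℚ (trans X-Zv≡ (ℤ.*-comm u _)) ⟩
    ℤ→ℚ (+ (p ℕ.^ e) ℤ.* u)     ∎)

module Diagonal where
  open import Defs
  open import Data.Nat
  open import Data.Nat.Properties
  open import Data.Nat.Combinatorics using (_C_)
  open import Data.Nat.Tactic.RingSolver
  open import Data.Sum using (inj₁; inj₂)
  open import Data.Rational as ℚ using ()
  open import Relation.Binary.PropositionalEquality
  open Binomials
  open Rationals using (÷ℕ-exact)
  open ≡-Reasoning

  -- On the diagonal, F(n,n) = (4n+1) C(2n,n) C(4n,2n) / 2^(6n).
  F-diagonal : ∀ n W Y → (4 * n + 1) * central n * central (n + n) * W ≡ Y →
               F n n ℚ.* ℕ→ℚ (2 ^ (6 * n) * W) ≡ ℕ→ℚ Y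
  F-diagonal n W Y eq = ÷ℕ-exact X D (2 ^ (6 * n) * W) Y D≢0 (begin
    X * (2 ^ (6 * n) * W)                                 ≡⟨ cong (_* (2 ^ (6 * n) * W)) X≡ ⟩
    (4 * n + 1) * c * c′ * 1 * c * (2 ^ (6 * n) * W)      ≡⟨ regroup (4 * n + 1) c c′ (2 ^ (6 * n)) W ⟩
    2 ^ (6 * n) * c * ((4 * n + 1) * c * c′ * W)          ≡⟨ cong₂ _*_ (sym D≡) eq ⟩
    D * Y                                                 ∎)
    where
    c c′ X D : ℕ
    c  = central n
    c′ = central (n + n)
    X = (6 * n ∸ 2 * n + 1) * ((2 * n) C n) * ((2 * n + 2 * n) C (n + n))
        * ((2 * n ∸ 2 * n) C (n ∸ n)) * ((n + n) C n)
    D = 2 ^ (8 * n ∸ 2 * n) * ((2 * n) C n)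
    two-n : 2 * n ≡ n + n
    two-n = cong (n +_) (+-identityʳ n)
    drop-2n : ∀ k → (k * n + 2 * n) ∸ 2 * n ≡ k * n
    drop-2n k = m+n∸n≡m (k * n) (2 * n)
    six-minus-two : 6 * n ∸ 2 * n ≡ 4 * n
    six-minus-two = trans (cong (_∸ 2 * n) (*-distribʳ-+ n 4 2)) (drop-2n 4)
    eight-minus-two : 8 * n ∸ 2 * n ≡ 6 * n
    eight-minus-two = trans (cong (_∸ 2 * n) (*-distribʳ-+ n 6 2)) (drop-2n 6)
    c≡ : (2 * n) C n ≡ c
    c≡ = cong (_C n) two-n
    X≡ : X ≡ (4 * n + 1) * c * c′ * 1 * c
    X≡ = cong (_* c) (cong₂ _*_ (cong₂ _*_ (cong₂ _*_ (cong (_+ 1) six-minus-two) c≡)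
                                           (cong (_C (n + n)) (cong₂ _+_ two-n two-n)))
                                (cong₂ _C_ (n∸n≡0 (2 * n)) (n∸n≡0 n)))
    D≡ : D ≡ 2 ^ (6 * n) * c
    D≡ = cong₂ (λ e x → 2 ^ e * x) eight-minus-two c≡
    D≢0 : D ≢ 0
    D≢0 D≡0 with m*n≡0⇒m≡0∨n≡0 (2 ^ (6 * n)) (trans (sym D≡) D≡0)
    ... | inj₁ 2^6n≡0 = <⇒≢ (m^n>0 2 (6 * n)) (sym 2^6n≡0)
    ... | inj₂ c≡0    = <⇒≢ (C-pos (m≤m+n n n)) (sym c≡0)
    regroup : ∀ a c c′ g W → a * c * c′ * 1 * c * (g * W) ≡ g * c * (a * c * c′ * W)
    regroup = solve-∀

  -- C(2n,n) C(4n,2n) expressed through C(2p,p) C(4p,2p), p = n+1, using the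
  -- recurrence of central binomial coefficients three times:
  -- (4n+1) C(2n,n) C(4n,2n) · 4(4p-1) = p² C(2p,p) C(4p,2p).
  diagonal-identity : ∀ n → (4 * n + 1) * central n * central (n + n) * (4 * (4 * n + 3))
                            ≡ suc n * suc n * central (suc n) * central (suc n + suc n)
  diagonal-identity n = sym (*-cancelˡ-≡ _ _ (2 * A) (begin
    2 * A * (suc n * suc n * e * d)
      ≡⟨ cong (λ x → 2 * A * (suc n * suc n * e * central x)) (cong suc (+-suc n n)) ⟩
    2 * A * (suc n * suc n * e * d′)
      ≡⟨ split n e d′ ⟩
    suc n * e * (suc (suc (n + n)) * d′) * A
      ≡⟨ cong₂ (λ x y → x * y * A) (central-step n) (central-step (suc (n + n))) ⟩
    2 * (A * c) * (2 * (suc (suc (n + n) + suc (n + n)) * B)) * A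
      ≡⟨ gather n c B ⟩
    4 * suc (suc (n + n) + suc (n + n)) * c * A * (A * B)
      ≡⟨ cong (4 * suc (suc (n + n) + suc (n + n)) * c * A *_) (central-step (n + n)) ⟩
    4 * suc (suc (n + n) + suc (n + n)) * c * A * (2 * (suc ((n + n) + (n + n)) * c′))
      ≡⟨ finish n c c′ ⟩
    2 * A * ((4 * n + 1) * c * c′ * (4 * (4 * n + 3))) ∎))
    where
    A c c′ B e d d′ : ℕ
    A  = suc (n + n)
    c  = central n
    c′ = central (n + n)
    B  = central (suc (n + n))
    e  = central (suc n)
    d  = central (suc n + suc n)
    d′ = central (suc (suc (n + n)))
    split : ∀ n e d → 2 * suc (n + n) * (suc n * suc n * e * d)
                      ≡ suc n * e * (suc (suc (n + n)) * d) * suc (n + n)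
    split = solve-∀
    gather : ∀ n c B → 2 * (suc (n + n) * c) * (2 * (suc (suc (n + n) + suc (n + n)) * B)) * suc (n + n)
                       ≡ 4 * suc (suc (n + n) + suc (n + n)) * c * suc (n + n) * (suc (n + n) * B)
    gather = solve-∀
    finish : ∀ n c c′ → 4 * suc (suc (n + n) + suc (n + n)) * c * suc (n + n) * (2 * (suc ((n + n) + (n + n)) * c′))
                        ≡ 2 * suc (n + n) * ((4 * n + 1) * c * c′ * (4 * (4 * n + 3)))
    finish = solve-∀

module Integral where
  open import Defs using (ℕ→ℚ; ℤ→ℚ; qp2)
  open import Data.Nat as ℕ using (ℕ; suc)
  import Data.Nat.Properties as ℕ
  open import Data.Integer hiding (suc)
  import Data.Integer.Properties as ℤ
  open import Data.Integer.Divisibility.Signed using (_∣_; divides)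
  open import Data.Integer.Tactic.RingSolver
  import Data.Nat.Tactic.RingSolver as ℕ-Solver
  open import Data.Rational as ℚ using (ℚ)
  open import Relation.Binary.PropositionalEquality
  open Rationals using (ℤ→ℚ-+; ℤ→ℚ-*; ℤ→ℚ-neg; qp2-integral)
  open ≡-Reasoning

  target : ℤ → ℤ → ℤ
  target p q = - (+ 3 * (p * p)) + - (+ 12 * (p * p * p)) + + 18 * (p * p * p) * q

  -- With e = 2 + a p², d = 6 + t p²
  -- and w = 1 + 6pq + s p², the number p² e d - target(p,q) · 4(4p-1) w is
  -- p⁴ times an explicit integer, because e d ≡ 12 (mod p²) and
  -- 4(4p-1)(3 + 12p - 18pq)(1 + 6pq) = -12 + 48 p² (4 - 6q + 9q² + 24pq - 36pq²).
  key-identity : ∀ p q a t s →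
    p * p * (+ 2 + a * (p * p)) * (+ 6 + t * (p * p))
      - (- (+ 3 * (p * p)) + - (+ 12 * (p * p * p)) + + 18 * (p * p * p) * q)
        * ((+ 1 + (+ 6 * q + s * p) * p) * (+ 4 * (+ 4 * p - + 1)))
    ≡ (+ 6 * a + + 2 * t + a * t * (p * p)
       + + 48 * (+ 4 - + 6 * q + + 9 * q * q + + 24 * p * q - + 36 * p * q * q)
       + + 4 * s * (+ 4 * p - + 1) * (+ 3 + + 12 * p - + 18 * p * q))
      * (p * p * p * p)
  key-identity = solve-∀

  pos-affine : ∀ c k m → + (c ℕ.+ k ℕ.* m) ≡ + c + + k * + m
  pos-affine c k m = trans (ℤ.pos-+ c (k ℕ.* m)) (cong (λ z → + c + z) (ℤ.pos-* k m))

  pos-square : ∀ p → + (p ℕ.* p) ≡ + p * + p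
  pos-square p = ℤ.pos-* p p

  pos-cube : ∀ p → + (p ℕ.* p ℕ.* p) ≡ + p * + p * + p
  pos-cube p = trans (ℤ.pos-* (p ℕ.* p) p) (cong (_* + p) (pos-square p))

  pos-fourth : ∀ p → + (p ℕ.* p ℕ.* p ℕ.* p) ≡ + p * + p * + p * + p
  pos-fourth p = trans (ℤ.pos-* (p ℕ.* p ℕ.* p) p) (cong (_* + p) (pos-cube p))

  pow2 : ∀ p → p ℕ.^ 2 ≡ p ℕ.* p
  pow2 p = cong (p ℕ.*_) (ℕ.*-identityʳ p)

  pow3 : ∀ p → p ℕ.^ 3 ≡ p ℕ.* p ℕ.* p
  pow3 p = trans (cong (p ℕ.*_) (pow2 p)) (sym (ℕ.*-assoc p p p))

  pow4 : ∀ p → p ℕ.^ 4 ≡ p ℕ.* p ℕ.* p ℕ.* p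
  pow4 p = trans (cong (p ℕ.*_) (pow3 p)) (reassociate p)
    where
    reassociate : ∀ p → p ℕ.* (p ℕ.* p ℕ.* p) ≡ p ℕ.* p ℕ.* p ℕ.* p
    reassociate = ℕ-Solver.solve-∀

  integral-congruence : ∀ n q a t s {e d w} → let p = suc n in
    e ≡ 2 ℕ.+ a ℕ.* (p ℕ.* p) → d ≡ 6 ℕ.+ t ℕ.* (p ℕ.* p) → w ≡ 1 ℕ.+ (6 ℕ.* q ℕ.+ s ℕ.* p) ℕ.* p →
    + (p ℕ.^ 4) ∣ + (p ℕ.* p ℕ.* e ℕ.* d) - target (+ p) (+ q) * + (w ℕ.* (4 ℕ.* (4 ℕ.* n ℕ.+ 3)))
  integral-congruence n q a t s {e} {d} {w} e≡ d≡ w≡ = divides u (begin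
    + (p ℕ.* p ℕ.* e ℕ.* d) - target P Q * + (w ℕ.* (4 ℕ.* (4 ℕ.* n ℕ.+ 3)))
      ≡⟨ cong₂ (λ y v → y - target P Q * v) Y≡ V≡ ⟩
    P * P * + e * + d - target P Q * (+ w * (+ 4 * (+ 4 * P - + 1)))
      ≡⟨ cong₂ (λ y w′ → y - target P Q * (w′ * (+ 4 * (+ 4 * P - + 1))))
               (cong₂ (λ e′ d′ → P * P * e′ * d′) E≡ D≡) W≡ ⟩
    P * P * (+ 2 + + a * (P * P)) * (+ 6 + + t * (P * P))
      - target P Q * ((+ 1 + (+ 6 * Q + + s * P) * P) * (+ 4 * (+ 4 * P - + 1)))
      ≡⟨ key-identity P Q (+ a) (+ t) (+ s) ⟩
    u * (P * P * P * P)
      ≡⟨ cong (u *_) (sym (trans (cong +_ (pow4 p)) (pos-fourth p))) ⟩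
    u * + (p ℕ.^ 4) ∎)
    where
    p : ℕ
    p = suc n
    P Q u : ℤ
    P = + p
    Q = + q
    u = + 6 * + a + + 2 * + t + + a * + t * (P * P)
        + + 48 * (+ 4 - + 6 * Q + + 9 * Q * Q + + 24 * P * Q - + 36 * P * Q * Q)
        + + 4 * + s * (+ 4 * P - + 1) * (+ 3 + + 12 * P - + 18 * P * Q)
    ofSquare : ∀ c k → + (c ℕ.+ k ℕ.* (p ℕ.* p)) ≡ + c + + k * (P * P)
    ofSquare c k = trans (pos-affine c k (p ℕ.* p)) (cong (λ z → + c + + k * z) (pos-square p))
    E≡ : + e ≡ + 2 + + a * (P * P)
    E≡ = trans (cong +_ e≡) (ofSquare 2 a)
    D≡ : + d ≡ + 6 + + t * (P * P)
    D≡ = trans (cong +_ d≡) (ofSquare 6 t)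
    W≡ : + w ≡ + 1 + (+ 6 * Q + + s * P) * P
    W≡ = trans (cong +_ w≡) (trans (pos-affine 1 (6 ℕ.* q ℕ.+ s ℕ.* p) p)
           (cong (λ z → + 1 + z * P) (trans (ℤ.pos-+ (6 ℕ.* q) (s ℕ.* p)) (cong₂ _+_ (ℤ.pos-* 6 q) (ℤ.pos-* s p)))))
    Y≡ : + (p ℕ.* p ℕ.* e ℕ.* d) ≡ P * P * + e * + d
    Y≡ = trans (ℤ.pos-* (p ℕ.* p ℕ.* e) d) (cong (_* + d) (trans (ℤ.pos-* (p ℕ.* p) e) (cong (_* + e) (pos-square p))))
    V≡ : + (w ℕ.* (4 ℕ.* (4 ℕ.* n ℕ.+ 3))) ≡ + w * (+ 4 * (+ 4 * P - + 1))
    V≡ = trans (ℤ.pos-* w _) (cong (λ z → + w * z) (trans (ℤ.pos-* 4 (4 ℕ.* n ℕ.+ 3))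
           (cong (+ 4 *_) (trans (trans (ℤ.pos-+ (4 ℕ.* n) 3) (cong (_+ + 3) (ℤ.pos-* 4 n)))
                                 (trans (shift (+ n)) (cong (λ z → + 4 * z - + 1) (sym (ℤ.pos-+ 1 n))))))))
      where
      shift : ∀ N → + 4 * N + + 3 ≡ + 4 * (+ 1 + N) - + 1
      shift = solve-∀

  target-ℚ : ∀ n q → 2 ℕ.^ n ≡ 1 ℕ.+ suc n ℕ.* q → let p = suc n in
    (ℚ.- (ℕ→ℚ 3 ℚ.* ℕ→ℚ (p ℕ.^ 2))) ℚ.+ (ℚ.- (ℕ→ℚ 12 ℚ.* ℕ→ℚ (p ℕ.^ 3)))
      ℚ.+ ℕ→ℚ 18 ℚ.* ℕ→ℚ (p ℕ.^ 3) ℚ.* qp2 p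
    ≡ ℤ→ℚ (target (+ p) (+ q))
  target-ℚ n q 2^n≡ = begin
    (ℚ.- (ι (+ 3) ℚ.* ι (+ (p ℕ.^ 2)))) ℚ.+ (ℚ.- (ι (+ 12) ℚ.* ι (+ (p ℕ.^ 3))))
      ℚ.+ ι (+ 18) ℚ.* ι (+ (p ℕ.^ 3)) ℚ.* qp2 p
      ≡⟨ cong₂ (λ x y → (ℚ.- (ι (+ 3) ℚ.* ι x)) ℚ.+ (ℚ.- (ι (+ 12) ℚ.* ι y)) ℚ.+ ι (+ 18) ℚ.* ι y ℚ.* qp2 p)
               (trans (cong +_ (pow2 p)) (pos-square p)) (trans (cong +_ (pow3 p)) (pos-cube p)) ⟩
    (ℚ.- (ι (+ 3) ℚ.* ι (P * P))) ℚ.+ (ℚ.- (ι (+ 12) ℚ.* ι (P * P * P)))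
      ℚ.+ ι (+ 18) ℚ.* ι (P * P * P) ℚ.* qp2 p
      ≡⟨ cong (λ z → (ℚ.- (ι (+ 3) ℚ.* ι (P * P))) ℚ.+ (ℚ.- (ι (+ 12) ℚ.* ι (P * P * P)))
                       ℚ.+ ι (+ 18) ℚ.* ι (P * P * P) ℚ.* z) (qp2-integral n q 2^n≡) ⟩
    (ℚ.- (ι (+ 3) ℚ.* ι (P * P))) ℚ.+ (ℚ.- (ι (+ 12) ℚ.* ι (P * P * P)))
      ℚ.+ ι (+ 18) ℚ.* ι (P * P * P) ℚ.* ι (+ q)
      ≡⟨ sym (ℤ→ℚ-target P (+ q)) ⟩
    ι (target P (+ q)) ∎
    where
    p : ℕ
    p = suc n
    P : ℤ
    P = + p
    ι : ℤ → ℚ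
    ι = ℤ→ℚ
    ℤ→ℚ-target : ∀ p q → ι (target p q)
      ≡ (ℚ.- (ι (+ 3) ℚ.* ι (p * p))) ℚ.+ (ℚ.- (ι (+ 12) ℚ.* ι (p * p * p)))
          ℚ.+ ι (+ 18) ℚ.* ι (p * p * p) ℚ.* ι q
    ℤ→ℚ-target p q
      rewrite ℤ→ℚ-+ (- (+ 3 * (p * p)) + - (+ 12 * (p * p * p))) (+ 18 * (p * p * p) * q)
            | ℤ→ℚ-+ (- (+ 3 * (p * p))) (- (+ 12 * (p * p * p)))
            | ℤ→ℚ-neg (+ 3 * (p * p)) | ℤ→ℚ-neg (+ 12 * (p * p * p))
            | ℤ→ℚ-* (+ 3) (p * p) | ℤ→ℚ-* (+ 12) (p * p * p)
            | ℤ→ℚ-* (+ 18 * (p * p * p)) q | ℤ→ℚ-* (+ 18) (p * p * p) = refl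

open import Defs
open import Data.Nat using (ℕ; _>_; _∸_; _^_)
open import Data.Nat.Primality using (Prime)
open import Data.Rational using (_+_; _*_; -_)
open import Data.Nat as ℕ using (suc; _<_)
open import Data.Nat.Properties using (<⇒≤)
open import Data.Integer using (+_)
open import Data.Product using (_,_)
open Binomials using (central)
open Powers using (sixth-power)
open Primes using (∤-denominator)
open PrimeBinomials using (central-prime; central-double-prime; fermat-two)
open Rationals using (CongQ-fromℤ)
open Diagonal using (F-diagonal; diagonal-identity)
open Integral using (target; integral-congruence; target-ℚ)

-- With n = p - 1, V = 2^(6n) · 4(4n+3) and Y = p² C(2p,p) C(4p,2p) we have
-- F(n,n) V = Y, while Y - target · V is divisible by p⁴.
lemma2p1 : (p : ℕ) → Prime p → p > 3 →
    CongQ p 4 (F (p ∸ 1) (p ∸ 1))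
      ((- (ℕ→ℚ 3 * ℕ→ℚ (p ^ 2))) + (- (ℕ→ℚ 12 * ℕ→ℚ (p ^ 3)))
        + ℕ→ℚ 18 * ℕ→ℚ (p ^ 3) * qp2 p)
lemma2p1 p@(suc n) p-prime p>3 =
  let a , e≡   = central-prime p p-prime
      t , d≡   = central-double-prime p p-prime
      q , 2^n≡ = fermat-two p p-prime 2<p
      s , w≡   = sixth-power n p q 2^n≡
  in CongQ-fromℤ p 4 (F n n) _ V (+ Y) (target (+ p) (+ q))
       (∤-denominator n p-prime 2<p)
       (F-diagonal n W Y (diagonal-identity n))
       (target-ℚ n q 2^n≡)
       (integral-congruence n q a t s e≡ d≡ w≡)
  where
  2<p : 2 < p
  2<p = <⇒≤ p>3
  W V Y : ℕ
  W = 4 ℕ.* (4 ℕ.* n ℕ.+ 3)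
  V = 2 ^ (6 ℕ.* n) ℕ.* W
  Y = p ℕ.* p ℕ.* central p ℕ.* central (p ℕ.+ p)
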